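{- Let $(A,\dagger)$ be a finite involutory alphabet and $L\subseteq A^{+}$. If $L$ is recognised by a finite semigroup, then $L$ is recognised by a finite involution semigroup.
   Context: A finite involutory alphabet $(A,\dagger)$ is a finite set with a bijection $\dagger$ satisfying $(a^\dagger)^\dagger=a$, extended to $A^{+}$ by $(a_1\cdots a_n)^\dagger=a_n^\dagger\cdots a_1^\dagger$. A semigroup $S$ recognises $L$ if there are a semigroup morphism $h:A^{+}\to S$ and $P\subseteq S$ with $L=h^{ -1}(P)$. An involution semigroup $(S,\star)$ satisfies $(a^\star)^\star=a$, $(ab)^\star=b^\star a^\star$, and recognises $L$ if there are a semigroup morphism $h:A^{+}\to S$ with $h(w^\dagger)=h(w)^\star$ for all $w$ and $P\subseteq S$ with $L=h^{ -1}(P)$. -}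

module Defs where

open import Data.Nat using (ℕ)
open import Data.Fin using (Fin)
open import Data.List.NonEmpty using (List⁺; _⁺++⁺_; reverse) renaming (map to map⁺)
open import Data.Product using (Σ; _×_; ∃)
open import Relation.Binary.PropositionalEquality using (_≡_)
open import Function.Bundles using (_⇔_)

record InvAlphabet (n : ℕ) : Set where
  field
    dag    : Fin n → Fin n
    dag-inv : ∀ a → dag (dag a) ≡ a

Word : ℕ → Set
Word n = List⁺ (Fin n)

wordDag : ∀ {n} → InvAlphabet n → Word n → Word n
wordDag Ad w = reverse (map⁺ (InvAlphabet.dag Ad) w)

Language : ℕ → Set₁
Language n = Word n → Set

record FinSemigroup : Set where
  field
    size  : ℕ
    _∙_   : Fin size → Fin size → Fin size
    assoc : ∀ x y z → (x ∙ y) ∙ z ≡ x ∙ (y ∙ z)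

record FinInvSemigroup : Set where
  field
    size     : ℕ
    _∙_      : Fin size → Fin size → Fin size
    assoc    : ∀ x y z → (x ∙ y) ∙ z ≡ x ∙ (y ∙ z)
    star     : Fin size → Fin size
    star-inv : ∀ x → star (star x) ≡ x
    star-anti : ∀ x y → star (x ∙ y) ≡ star y ∙ star x

IsMorphism : ∀ {n} {m : ℕ} → (Fin m → Fin m → Fin m) → (Word n → Fin m) → Set
IsMorphism _∙_ h = ∀ u v → h (u ⁺++⁺ v) ≡ h u ∙ h v

Recognises : ∀ {n} → FinSemigroup → Language n → Set₁
Recognises {n} S L =
  Σ (Word n → Fin size) λ h →
  Σ (Fin size → Set) λ P →
    IsMorphism _∙_ h × (∀ w → L w ⇔ P (h w))
  where open FinSemigroup S

InvRecognises : ∀ {n} → InvAlphabet n → FinInvSemigroup → Language n → Set₁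
InvRecognises {n} Ad S L =
  Σ (Word n → Fin size) λ h →
  Σ (Fin size → Set) λ P →
    IsMorphism _∙_ h
    × (∀ w → h (wordDag Ad w) ≡ star (h w))
    × (∀ w → L w ⇔ P (h w))
  where open FinInvSemigroup S

{-# OPTIONS --safe #-}
-- The product S × Sᵒᵖ of a semigroup with its opposite is an involution
-- semigroup under (a , b) ⋆ = (b , a). If h : A⁺ → S recognises L, then
-- w ↦ (h w , h w†) is a morphism into S × Sᵒᵖ which turns † into ⋆, and
-- it recognises L through its first component.
module Submission where

open import Defs
open import Algebra.Core using (Op₁; Op₂)
open import Data.Nat using (ℕ; suc)
open import Data.Fin using (Fin)
open import Data.Fin.Properties using (*↔×)
open import Data.Product using (Σ; _,_; _×_; proj₁)
import Data.List as List
import Data.List.Properties as List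
open import Data.List.NonEmpty using (List⁺; _∷_; toList; _⁺++⁺_; reverse; toVec; fromVec)
  renaming (map to map⁺)
import Data.Vec as Vec
import Data.Vec.Properties as Vec
open import Function using (_∘_; id)
open import Function.Bundles using (_↔_; Inverse; _⇔_)
open import Relation.Binary.PropositionalEquality

private
  variable
    A : Set

toList-injective : {xs ys : List⁺ A} → toList xs ≡ toList ys → xs ≡ ys
toList-injective {xs = _ ∷ _} {ys = _ ∷ _} refl = refl

toList-fromVec : ∀ {n} (v : Vec.Vec A (suc n)) → toList (fromVec v) ≡ Vec.toList v
toList-fromVec (_ Vec.∷ _) = refl

toList-reverse : (xs : List⁺ A) → toList (reverse xs) ≡ List.reverse (toList xs)
toList-reverse xs@(x ∷ xs′) = begin
  toList (reverse xs)                  ≡⟨ toList-fromVec (Vec.reverse (toVec xs)) ⟩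
  Vec.toList (Vec.reverse (toVec xs))  ≡⟨ Vec.toList-reverse (toVec xs) ⟩
  List.reverse (Vec.toList (toVec xs)) ≡⟨ cong (List.reverse ∘ (x List.∷_)) (Vec.toList∘fromList xs′) ⟩
  List.reverse (toList xs)             ∎
  where open ≡-Reasoning

module _ {n : ℕ} (Ad : InvAlphabet n) where
  open InvAlphabet Ad

  toList-wordDag : (w : Word n) → toList (wordDag Ad w) ≡ List.reverse (List.map dag (toList w))
  toList-wordDag w = toList-reverse (map⁺ dag w)

  wordDag-++ : (u v : Word n) → wordDag Ad (u ⁺++⁺ v) ≡ wordDag Ad v ⁺++⁺ wordDag Ad u
  wordDag-++ u v = toList-injective (begin
    toList (wordDag Ad (u ⁺++⁺ v))
      ≡⟨ toList-wordDag (u ⁺++⁺ v) ⟩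
    List.reverse (List.map dag (toList u List.++ toList v))
      ≡⟨ cong List.reverse (List.map-++ dag (toList u) (toList v)) ⟩
    List.reverse (List.map dag (toList u) List.++ List.map dag (toList v))
      ≡⟨ List.reverse-++ (List.map dag (toList u)) (List.map dag (toList v)) ⟩
    List.reverse (List.map dag (toList v)) List.++ List.reverse (List.map dag (toList u))
      ≡⟨ cong₂ List._++_ (toList-wordDag v) (toList-wordDag u) ⟨
    toList (wordDag Ad v) List.++ toList (wordDag Ad u) ∎)
    where open ≡-Reasoning

  wordDag-involutive : (w : Word n) → wordDag Ad (wordDag Ad w) ≡ w
  wordDag-involutive w = toList-injective (begin
    toList (wordDag Ad (wordDag Ad w))
      ≡⟨ toList-wordDag (wordDag Ad w) ⟩
    List.reverse (List.map dag (toList (wordDag Ad w)))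
      ≡⟨ cong (List.reverse ∘ List.map dag) (toList-wordDag w) ⟩
    List.reverse (List.map dag (List.reverse (List.map dag (toList w))))
      ≡⟨ cong List.reverse (List.reverse-map dag (List.map dag (toList w))) ⟩
    List.reverse (List.reverse (List.map dag (List.map dag (toList w))))
      ≡⟨ List.reverse-involutive _ ⟩
    List.map dag (List.map dag (toList w))
      ≡⟨ List.map-∘ (toList w) ⟨
    List.map (dag ∘ dag) (toList w)
      ≡⟨ List.map-cong dag-inv (toList w) ⟩
    List.map id (toList w)
      ≡⟨ List.map-id (toList w) ⟩
    toList w ∎)
    where open ≡-Reasoning

record IsInvolutionSemigroup {X : Set} (_·_ : Op₂ X) (_⋆ : Op₁ X) : Set where
  field
    assoc        : ∀ x y z → (x · y) · z ≡ x · (y · z)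
    ⋆-involutive : ∀ x → (x ⋆) ⋆ ≡ x
    ⋆-anti       : ∀ x y → (x · y) ⋆ ≡ (y ⋆) · (x ⋆)

module ProductWithOpposite {X : Set} (_·_ : Op₂ X) (·-assoc : ∀ x y z → (x · y) · z ≡ x · (y · z)) where

  _⊗_ : Op₂ (X × X)
  (a , b) ⊗ (c , d) = (a · c , d · b)

  swap : Op₁ (X × X)
  swap (a , b) = (b , a)

  isInvolutionSemigroup : IsInvolutionSemigroup _⊗_ swap
  isInvolutionSemigroup = record
    { assoc        = λ { (a , b) (c , d) (e , f) → cong₂ _,_ (·-assoc a c e) (sym (·-assoc f d b)) }
    ; ⋆-involutive = λ _ → refl
    ; ⋆-anti       = λ _ _ → refl
    }

  module _ {n : ℕ} (Ad : InvAlphabet n) (h : Word n → X) where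

    withDag : Word n → X × X
    withDag w = (h w , h (wordDag Ad w))

    withDag-hom : (∀ u v → h (u ⁺++⁺ v) ≡ h u · h v) →
                  ∀ u v → withDag (u ⁺++⁺ v) ≡ withDag u ⊗ withDag v
    withDag-hom h-hom u v = cong₂ _,_ (h-hom u v)
      (trans (cong h (wordDag-++ Ad u v)) (h-hom (wordDag Ad v) (wordDag Ad u)))

    withDag-dag : ∀ w → withDag (wordDag Ad w) ≡ swap (withDag w)
    withDag-dag w = cong (λ v → h (wordDag Ad w) , h v) (wordDag-involutive Ad w)

module FinTransport {X : Set} {k : ℕ} (e : Fin k ↔ X) {_·_ : Op₂ X} {_⋆ : Op₁ X}
                    (isInv : IsInvolutionSemigroup _·_ _⋆) where
  open Inverse e using () renaming (to to decode; from to encode;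
    strictlyInverseˡ to decode-encode; strictlyInverseʳ to encode-decode)
  open IsInvolutionSemigroup isInv
  open ≡-Reasoning

  _∙_ : Op₂ (Fin k)
  x ∙ y = encode (decode x · decode y)

  star : Op₁ (Fin k)
  star x = encode (decode x ⋆)

  ∙-assoc : ∀ x y z → (x ∙ y) ∙ z ≡ x ∙ (y ∙ z)
  ∙-assoc x y z = begin
    (x ∙ y) ∙ z                               ≡⟨ cong (λ u → encode (u · decode z)) (decode-encode _) ⟩
    encode ((decode x · decode y) · decode z) ≡⟨ cong encode (assoc _ _ _) ⟩
    encode (decode x · (decode y · decode z)) ≡⟨ cong (λ u → encode (decode x · u)) (decode-encode _) ⟨
    x ∙ (y ∙ z)                               ∎

  star-involutive : ∀ x → star (star x) ≡ x
  star-involutive x = begin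
    star (star x)           ≡⟨ cong (λ u → encode (u ⋆)) (decode-encode _) ⟩
    encode ((decode x ⋆) ⋆) ≡⟨ cong encode (⋆-involutive _) ⟩
    encode (decode x)       ≡⟨ encode-decode x ⟩
    x                       ∎

  star-anti : ∀ x y → star (x ∙ y) ≡ star y ∙ star x
  star-anti x y = begin
    star (x ∙ y)                          ≡⟨ cong (λ u → encode (u ⋆)) (decode-encode _) ⟩
    encode ((decode x · decode y) ⋆)      ≡⟨ cong encode (⋆-anti _ _) ⟩
    encode ((decode y ⋆) · (decode x ⋆))  ≡⟨ cong₂ (λ u v → encode (u · v)) (decode-encode _) (decode-encode _) ⟨
    star y ∙ star x                       ∎

  finInvSemigroup : FinInvSemigroup
  finInvSemigroup = record
    { size = k ; _∙_ = _∙_ ; assoc = ∙-assoc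
    ; star = star ; star-inv = star-involutive ; star-anti = star-anti }

  encode-· : ∀ x y → encode (x · y) ≡ encode x ∙ encode y
  encode-· x y = sym (cong₂ (λ u v → encode (u · v)) (decode-encode x) (decode-encode y))

  encode-⋆ : ∀ x → encode (x ⋆) ≡ star (encode x)
  encode-⋆ x = sym (cong (λ u → encode (u ⋆)) (decode-encode x))

  invRecognises : ∀ {n} (Ad : InvAlphabet n) {L : Language n} (g : Word n → X) (Q : X → Set) →
    (∀ u v → g (u ⁺++⁺ v) ≡ g u · g v) → (∀ w → g (wordDag Ad w) ≡ g w ⋆) →
    (∀ w → L w ⇔ Q (g w)) → InvRecognises Ad finInvSemigroup L
  invRecognises Ad g Q g-hom g-dag L⇔Q =
      encode ∘ g
    , Q ∘ decode
    , (λ u v → trans (cong encode (g-hom u v)) (encode-· (g u) (g v)))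
    , (λ w → trans (cong encode (g-dag w)) (encode-⋆ (g w)))
    , (λ w → subst (λ x → _ ⇔ Q x) (sym (decode-encode (g w))) (L⇔Q w))

proposition1 : (n : ℕ) (Ad : InvAlphabet n) (L : Language n) →
    Σ FinSemigroup (λ S → Recognises S L) →
    Σ FinInvSemigroup (λ S → InvRecognises Ad S L)
proposition1 n Ad L (S , h , P , h-hom , L⇔P) =
    finInvSemigroup
  , invRecognises Ad (withDag Ad h) (P ∘ proj₁)
      (withDag-hom Ad h h-hom) (withDag-dag Ad h) L⇔P
  where
  open FinSemigroup S using (size; _∙_; assoc)
  open ProductWithOpposite _∙_ assoc
  open FinTransport (*↔× {size} {size}) isInvolutionSemigroup
    using (finInvSemigroup; invRecognises)
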